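{- Let $p\geq 5$ be a prime and let $n$ be a positive integer such that $p$ divides the numerator of $H(n)$ (i.e. $\nu_p(H(n))\geq 1$) and $\nu_p(H(pn))\geq 0$. Then for each $k=1,\dots,p-1$, \[ \nu_p\!\left(H(pn+k)-\frac{H(n)}{p}-H(k)\right)\geq 1. \]
   Context: $H(N)=1+\frac12+\cdots+\frac1N$ is the $N$-th harmonic number; $\nu_p$ denotes the $p$-adic valuation on $\mathbb{Q}$, with $\nu_p(0)=\infty$. -}

module Defs where

open import Data.Nat using (ℕ; zero; suc; _^_; _+_)
open import Data.Nat.Divisibility using (_∣_)
open import Data.Integer using (ℤ; +_; -[1+_]; ∣_∣)
open import Data.Rational using (ℚ; ↥_; ↧ₙ_; 0ℚ; 1ℚ; _/_)
import Data.Rational as Q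
open import Relation.Nullary using (¬_)
open import Data.Product using (_×_)

H : ℕ → ℚ
H zero    = 0ℚ
H (suc n) = H n Q.+ ((+ 1) / suc n)

-- "ν_p(x) ≥ m" for an integer m, where ν_p is the p-adic valuation on ℚ
-- (ν_p(0) = ∞, so 0 satisfies every bound). For x = a/b in lowest terms,
-- ν_p(x) = ν_p(a) - ν_p(b), and at most one of them is nonzero, hence:
--   ν_p(x) ≥ j      (j ≥ 0)  iff  p^j divides a and p does not divide b
--   ν_p(x) ≥ -(j+1)          iff  p^(j+2) does not divide the denominator b
νₚ≥ : ℕ → ℚ → ℤ → Set
νₚ≥ p x (+ j)     = p ^ j ∣ ∣ ↥ x ∣ × ¬ (p ∣ ↧ₙ x)
νₚ≥ p x -[1+ j ]  = ¬ (p ^ suc (suc j) ∣ ↧ₙ x)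

{-# OPTIONS --safe #-}
-- Split H(pn+k) into the terms 1/(pi), i ≤ n, which sum to H(n)/p, the complete blocks
-- 1/(pi+1) + ⋯ + 1/(pi+p−1), i < n, and the partial block 1/(pn+1) + ⋯ + 1/(pn+k).
-- For odd p each complete block has ν_p ≥ 1: pairing 1/(pi+j) with 1/(pi+p−j) gives pairs
-- with numerator 2pi+p.  Each term 1/(pn+j) of the partial block differs from 1/j by
-- −pn/(j(pn+j)), so the partial block minus H(k) has ν_p ≥ 1 as well.
module Submission where

open import Defs
open import Data.Nat using (ℕ; _≤_; _<_; _*_; _+_; NonZero)
open import Data.Nat.Primality using (Prime)
open import Data.Integer using (+_)
open import Data.Rational using (ℚ; _-_; _/_) renaming (_*_ to _*ℚ_)

open import Data.Fin as Fin using (Fin; toℕ; opposite)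
open import Data.Fin.Permutation using (reverse)
open import Data.Fin.Properties using (toℕ<n; toℕ-inject₁; toℕ-fromℕ; opposite-prop)
open import Data.Integer as ℤ using (∣_∣)
open import Data.Integer.Divisibility.Signed as ℤ∣
  using (∣ᵤ⇒∣; ∣⇒∣ᵤ) renaming (_∣_ to _∣ℤ_)
open import Data.Integer.GCD using (gcd; gcd-zeroˡ)
import Data.Integer.Properties as ℤ
import Data.Integer.Tactic.RingSolver as ℤ-Solver
open import Data.Nat using (zero; suc; _∸_; s≤s; z≤n; nonTrivial⇒n>1)
open import Data.Nat.Divisibility
  using (_∣_; _∤_; _∣0; ∣-refl; ∣-trans; ∣m∣n⇒∣m+n; ∣m+n∣m⇒∣n; m∣m*n; n∣m*n; >⇒∤)
open import Data.Nat.Primality using (euclidsLemma; prime⇒nonTrivial)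
open import Data.Nat.Properties
  using (+-identityʳ; +-suc; +-comm; *-zeroʳ; *-suc; *-comm; <⇒≤; ≤-trans; m+[n∸m]≡n; ^-identityʳ)
import Data.Nat.Tactic.RingSolver as ℕ-Solver
open import Data.Product using (_,_)
open import Data.Rational using (↥_; ↧_; ↧ₙ_; 0ℚ; -_; toℚᵘ) renaming (_+_ to _+ℚ_)
import Data.Rational.Properties as ℚ
open import Algebra.Properties.CommutativeMonoid.Sum ℚ.+-0-commutativeMonoid
  using (sum; sum-syntax; sum-init-last; sum-cong-≗; ∑-distrib-+; ∑-permute)
open import Data.Rational.Solver using (module +-*-Solver)
open import Data.Rational.Unnormalised as ℚᵘ using (mkℚᵘ; _≃_)
import Data.Rational.Unnormalised.Properties as ℚᵘ
open import Data.Sum using ([_,_]′)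
open import Data.Vec.Functional using (Vector)
open import Function using (id; flip; _∘_)
open import Relation.Binary.PropositionalEquality
  using (_≡_; refl; sym; trans; cong; cong₂; subst; module ≡-Reasoning)
open import Relation.Nullary using (contradiction)

-- 1/ 0 = 0 is a junk value; it lets 1/_ be applied to index expressions without side conditions.
1/_ : ℕ → ℚ
1/ zero  = 0ℚ
1/ suc n = + 1 / suc n

↥-1/ : ∀ n → ↥ (1/ suc n) ≡ + 1
↥-1/ n = trans (sym (ℤ.*-identityʳ _))
  (trans (cong (↥ (1/ suc n) ℤ.*_) (sym (gcd-zeroˡ (+ suc n)))) (ℚ.↥-/ (+ 1) (suc n)))

↧-1/ : ∀ n → ↧ (1/ suc n) ≡ + suc n
↧-1/ n = trans (sym (ℤ.*-identityʳ _))
  (trans (cong (↧ (1/ suc n) ℤ.*_) (sym (gcd-zeroˡ (+ suc n)))) (ℚ.↧-/ (+ 1) (suc n)))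

↥-1/-* : ∀ n i → ↥ (1/ suc n) ℤ.* i ≡ i
↥-1/-* n i = trans (cong (ℤ._* i) (↥-1/ n)) (ℤ.*-identityˡ i)

1/-* : ∀ m n → 1/ (suc m * suc n) ≡ 1/ suc m *ℚ 1/ suc n
1/-* m n = ℚ.toℚᵘ-injective (ℚᵘ.≃-sym (ℚᵘ.≃-trans (ℚ.toℚᵘ-homo-* (1/ suc m) (1/ suc n))
  (ℚᵘ.≃-trans (ℚᵘ.*-cong (toℚᵘ-1/ m) (toℚᵘ-1/ n)) (ℚᵘ.≃-sym (toℚᵘ-1/ (n + m * suc n))))))
  where
  toℚᵘ-1/ : ∀ k → toℚᵘ (1/ suc k) ≃ mkℚᵘ (+ 1) k
  toℚᵘ-1/ k = ℚ.toℚᵘ-fromℚᵘ (mkℚᵘ (+ 1) k)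

∑-last : ∀ m (f : ℕ → ℚ) → ∑[ i < suc m ] f (toℕ i) ≡ ∑[ i < m ] f (toℕ i) +ℚ f m
∑-last m f = trans (sum-init-last {m} (f ∘ toℕ))
  (cong₂ _+ℚ_ (sum-cong-≗ {m} (cong f ∘ toℕ-inject₁)) (cong f (toℕ-fromℕ m)))

H-+ : ∀ a m → H (a + m) ≡ H a +ℚ ∑[ i < m ] 1/ suc (a + toℕ i)
H-+ a zero    = trans (cong H (+-identityʳ a)) (sym (ℚ.+-identityʳ (H a)))
H-+ a (suc m) = begin
  H (a + suc m)
    ≡⟨ cong H (+-suc a m) ⟩
  H (a + m) +ℚ 1/ suc (a + m)
    ≡⟨ cong (_+ℚ 1/ suc (a + m)) (H-+ a m) ⟩
  (H a +ℚ ∑[ i < m ] 1/ suc (a + toℕ i)) +ℚ 1/ suc (a + m)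
    ≡⟨ ℚ.+-assoc (H a) _ _ ⟩
  H a +ℚ (∑[ i < m ] 1/ suc (a + toℕ i) +ℚ 1/ suc (a + m))
    ≡⟨ cong (H a +ℚ_) (∑-last m (λ j → 1/ suc (a + j))) ⟨
  H a +ℚ ∑[ i < suc m ] 1/ suc (a + toℕ i) ∎
  where open ≡-Reasoning

opposite-+ : ∀ {n} (i : Fin n) → suc (toℕ i) + suc (toℕ (opposite i)) ≡ suc n
opposite-+ {n} i = begin
  suc (toℕ i) + suc (toℕ (opposite i))   ≡⟨ +-suc (suc (toℕ i)) _ ⟩
  suc (suc (toℕ i) + toℕ (opposite i))   ≡⟨ cong (λ o → suc (suc (toℕ i) + o)) (opposite-prop i) ⟩
  suc (suc (toℕ i) + (n ∸ suc (toℕ i)))  ≡⟨ cong suc (m+[n∸m]≡n (toℕ<n i)) ⟩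
  suc n                                  ∎
  where open ≡-Reasoning

module pAdic {p : ℕ} (p-prime : Prime p) where

  Integral : ℚ → Set
  Integral x = p ∤ ↧ₙ x

  record Divisible (x : ℚ) : Set where
    constructor _,_
    field
      p∣↥ : + p ∣ℤ ↥ x
      p∤↧ : Integral x

  ∤-* : ∀ {m n} → p ∤ m → p ∤ n → p ∤ m * n
  ∤-* p∤m p∤n p∣mn = [ p∤m , p∤n ]′ (euclidsLemma _ _ p-prime p∣mn)

  ∤-+ : ∀ {a b} → p ∣ a → p ∤ b → p ∤ a + b
  ∤-+ p∣a p∤b p∣a+b = p∤b (∣m+n∣m⇒∣n p∣a+b p∣a)

  -- Reducing i/n cancels a common factor g of i and n; since g ∣ n, p ∤ g, so p still divides
  -- the reduced numerator.
  divisible-/ : ∀ i n .{{_ : NonZero n}} → + p ∣ℤ i → p ∤ n → Divisible (i / n)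
  divisible-/ i n p∣i p∤n = ∣ᵤ⇒∣ p∣↥ , p∤↧
    where
    g : ℕ
    g = ∣ gcd i (+ n) ∣
    ↧*g≡n : ↧ₙ (i / n) * g ≡ n
    ↧*g≡n = ℤ.+-injective (trans (ℤ.pos-* (↧ₙ (i / n)) g) (ℚ.↧-/ i n))
    p∤g : p ∤ g
    p∤g p∣g = p∤n (∣-trans p∣g (subst (g ∣_) ↧*g≡n (n∣m*n (↧ₙ (i / n)))))
    p∤↧ : p ∤ ↧ₙ (i / n)
    p∤↧ p∣↧ = p∤n (∣-trans p∣↧ (subst (↧ₙ (i / n) ∣_) ↧*g≡n (m∣m*n g)))
    p∣↥*g : p ∣ ∣ ↥ (i / n) ∣ * g
    p∣↥*g = subst (p ∣_) (trans (cong ∣_∣ (sym (ℚ.↥-/ i n))) (ℤ.abs-* (↥ (i / n)) _))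
      (∣⇒∣ᵤ p∣i)
    p∣↥ : p ∣ ∣ ↥ (i / n) ∣
    p∣↥ = [ id , flip contradiction p∤g ]′ (euclidsLemma _ _ p-prime p∣↥*g)

  divisible⇒νₚ≥1 : ∀ {x} → Divisible x → νₚ≥ p x (+ 1)
  divisible⇒νₚ≥1 (p∣↥ , p∤↧) = subst (_∣ _) (sym (^-identityʳ p)) (∣⇒∣ᵤ p∣↥) , p∤↧

  divisible-0 : Divisible 0ℚ
  divisible-0 = ∣ᵤ⇒∣ (p ∣0) , >⇒∤ (nonTrivial⇒n>1 p {{prime⇒nonTrivial p-prime}})

  divisible-+-cross : ∀ x y → + p ∣ℤ ↥ x ℤ.* ↧ y ℤ.+ ↥ y ℤ.* ↧ x →
                      Integral x → Integral y → Divisible (x +ℚ y)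
  divisible-+-cross x@record{} y@record{} p∣cross p∤x p∤y =
    divisible-/ _ _ p∣cross (∤-* p∤x p∤y)

  divisible-+ : ∀ {x y} → Divisible x → Divisible y → Divisible (x +ℚ y)
  divisible-+ {x} {y} (p∣x , p∤x) (p∣y , p∤y) =
    divisible-+-cross x y (ℤ∣.∣m∣n⇒∣m+n (ℤ∣.∣m⇒∣m*n (↧ y) p∣x) (ℤ∣.∣m⇒∣m*n (↧ x) p∣y))
      p∤x p∤y

  divisible-* : ∀ {x y} → Divisible x → Integral y → Divisible (x *ℚ y)
  divisible-* {x@record{}} {y@record{}} (p∣x , p∤x) p∤y =
    divisible-/ _ _ (ℤ∣.∣m⇒∣m*n (↥ y) p∣x) (∤-* p∤x p∤y)

  divisible-sum : ∀ {m} (f : Vector ℚ m) → (∀ i → Divisible (f i)) → Divisible (sum f)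
  divisible-sum {zero}  f df = divisible-0
  divisible-sum {suc m} f df =
    divisible-+ (df Fin.zero) (divisible-sum (f ∘ Fin.suc) (df ∘ Fin.suc))

  integral-1/ : ∀ {n} → p ∤ suc n → Integral (1/ suc n)
  integral-1/ {n} = subst (p ∤_) (sym (cong ∣_∣ (↧-1/ n)))

  divisible-1/+1/ : ∀ x y → p ∤ suc x → p ∤ suc y → p ∣ suc x + suc y →
                    Divisible (1/ suc x +ℚ 1/ suc y)
  divisible-1/+1/ x y p∤x p∤y p∣x+y = divisible-+-cross (1/ suc x) (1/ suc y)
    (subst (+ p ∣ℤ_) (sym numerator) (∣ᵤ⇒∣ p∣x+y)) (integral-1/ p∤x) (integral-1/ p∤y)
    where
    open ≡-Reasoning
    numerator : ↥ (1/ suc x) ℤ.* ↧ (1/ suc y) ℤ.+ ↥ (1/ suc y) ℤ.* ↧ (1/ suc x) ≡ + (suc x + suc y)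
    numerator = begin
      ↥ (1/ suc x) ℤ.* ↧ (1/ suc y) ℤ.+ ↥ (1/ suc y) ℤ.* ↧ (1/ suc x)
        ≡⟨ cong₂ ℤ._+_ (↥-1/-* x _) (↥-1/-* y _) ⟩
      ↧ (1/ suc y) ℤ.+ ↧ (1/ suc x)
        ≡⟨ cong₂ ℤ._+_ (↧-1/ y) (↧-1/ x) ⟩
      + suc y ℤ.+ + suc x
        ≡⟨ ℤ.+-comm (+ suc y) (+ suc x) ⟩
      + suc x ℤ.+ + suc y
        ≡⟨ ℤ.pos-+ (suc x) (suc y) ⟨
      + (suc x + suc y) ∎

  divisible-1/-1/ : ∀ {a} y → p ∣ a → p ∤ suc y → Divisible (1/ suc (a + y) - 1/ suc y)
  divisible-1/-1/ {a} y p∣a p∤y = divisible-+-cross u (- v)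
    (subst (+ p ∣ℤ_) (sym numerator) (ℤ∣.∣m⇒∣-m (∣ᵤ⇒∣ p∣a)))
    (integral-1/ (subst (p ∤_) (+-suc a y) (∤-+ p∣a p∤y)))
    (subst (p ∤_) (sym (cong ∣_∣ (ℚ.↧-neg v))) (integral-1/ p∤y))
    where
    open ≡-Reasoning
    u v : ℚ
    u = 1/ suc (a + y)
    v = 1/ suc y
    cancel : ∀ a y → (+ 1 ℤ.+ y) ℤ.+ ℤ.- (+ 1 ℤ.+ (a ℤ.+ y)) ≡ ℤ.- a
    cancel = ℤ-Solver.solve-∀
    numerator : ↥ u ℤ.* ↧ (- v) ℤ.+ ↥ (- v) ℤ.* ↧ u ≡ ℤ.- + a
    numerator = begin
      ↥ u ℤ.* ↧ (- v) ℤ.+ ↥ (- v) ℤ.* ↧ u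
        ≡⟨ cong₂ ℤ._+_ (↥-1/-* (a + y) _) (cong (ℤ._* ↧ u) (ℚ.↥-neg v)) ⟩
      ↧ (- v) ℤ.+ ℤ.- ↥ v ℤ.* ↧ u
        ≡⟨ cong₂ ℤ._+_ (ℚ.↧-neg v) (sym (ℤ.neg-distribˡ-* (↥ v) (↧ u))) ⟩
      ↧ v ℤ.+ ℤ.- (↥ v ℤ.* ↧ u)
        ≡⟨ cong₂ (λ d n → d ℤ.+ ℤ.- n) (↧-1/ y) (trans (↥-1/-* y (↧ u)) (↧-1/ (a + y))) ⟩
      + suc y ℤ.+ ℤ.- + suc (a + y)
        ≡⟨ cong₂ (λ d n → d ℤ.+ ℤ.- n) (ℤ.pos-+ 1 y)
                 (trans (ℤ.pos-+ 1 (a + y)) (cong (ℤ._+_ (+ 1)) (ℤ.pos-+ a y))) ⟩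
      (+ 1 ℤ.+ + y) ℤ.+ ℤ.- (+ 1 ℤ.+ (+ a ℤ.+ + y))
        ≡⟨ cancel (+ a) (+ y) ⟩
      ℤ.- + a ∎

  divisible-∑-1/-H : ∀ {a} → p ∣ a → ∀ k → k < p →
                     Divisible (∑[ i < k ] 1/ suc (a + toℕ i) - H k)
  divisible-∑-1/-H p∣a zero    k<p = divisible-0
  divisible-∑-1/-H {a} p∣a (suc k) k<p = subst Divisible (sym split)
    (divisible-+ (divisible-∑-1/-H p∣a k (<⇒≤ k<p)) (divisible-1/-1/ k p∣a (>⇒∤ k<p)))
    where
    open +-*-Solver
    S : ℚ
    S = ∑[ i < k ] 1/ suc (a + toℕ i)
    split : ∑[ i < suc k ] 1/ suc (a + toℕ i) - H (suc k)
            ≡ (S - H k) +ℚ (1/ suc (a + k) - 1/ suc k)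
    split = trans (cong (_- H (suc k)) (∑-last k (λ j → 1/ suc (a + j))))
      (solve 4 (λ s h x y → (s :+ x) :- (h :+ y) := (s :- h) :+ (x :- y)) refl
        S (H k) (1/ suc (a + k)) (1/ suc k))

module OddPrime {q : ℕ} (p-prime : Prime (suc q)) (p∤2 : suc q ∤ 2) where

  open pAdic p-prime

  private
    p : ℕ
    p = suc q

  -- Adding the sum to its reverse pairs 1/(a+j) with 1/(a+p−j), whose sum has numerator 2a+p.
  divisible-block : ∀ {a} → p ∣ a → Divisible (∑[ i < q ] 1/ suc (a + toℕ i))
  divisible-block {a} p∣a = subst Divisible halve
    (divisible-* (subst Divisible (sym pair-up) (divisible-sum _ pair)) (integral-1/ p∤2))
    where
    open +-*-Solver
    f : Fin q → ℚ
    f i = 1/ suc (a + toℕ i)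
    T : ℚ
    T = sum f
    pair-up : T +ℚ T ≡ ∑[ i < q ] (f i +ℚ f (opposite i))
    pair-up = trans (cong (T +ℚ_) (∑-permute f reverse)) (sym (∑-distrib-+ f (f ∘ opposite)))
    rearrange : ∀ a j k → suc (a + j) + suc (a + k) ≡ (a + a) + (suc j + suc k)
    rearrange = ℕ-Solver.solve-∀
    p∤a+1+i : ∀ i → p ∤ suc (a + toℕ i)
    p∤a+1+i i = subst (p ∤_) (+-suc a _) (∤-+ p∣a (>⇒∤ (s≤s (toℕ<n i))))
    pair : ∀ i → Divisible (f i +ℚ f (opposite i))
    pair i = divisible-1/+1/ (a + toℕ i) (a + toℕ (opposite i)) (p∤a+1+i i) (p∤a+1+i (opposite i))
      (subst (p ∣_) (sym (trans (rearrange a (toℕ i) (toℕ (opposite i)))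
                                (cong (_+_ (a + a)) (opposite-+ i))))
        (∣m∣n⇒∣m+n (∣m∣n⇒∣m+n p∣a p∣a) ∣-refl))
    halve : (T +ℚ T) *ℚ 1/ 2 ≡ T
    halve = solve 1 (λ t → (t :+ t) :* con (1/ 2) := t) refl T

  divisible-H[pn]-H[n]/p : ∀ n → Divisible (H (p * n) - H n *ℚ 1/ p)
  divisible-H[pn]-H[n]/p zero =
    subst Divisible (sym (cong₂ (λ m z → H m - z) (*-zeroʳ p) (ℚ.*-zeroˡ (1/ p)))) divisible-0
  divisible-H[pn]-H[n]/p (suc n) = subst Divisible (sym split)
    (divisible-+ (divisible-H[pn]-H[n]/p n) (divisible-block (m∣m*n n)))
    where
    open ≡-Reasoning
    open +-*-Solver
    B : ℚ
    B = ∑[ i < q ] 1/ suc (p * n + toℕ i)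
    last-term : suc (p * n + q) ≡ suc n * p
    last-term = cong suc (trans (+-comm (p * n) q) (cong (_+_ q) (*-comm p n)))
    H-p*suc : H (p * suc n) ≡ H (p * n) +ℚ (B +ℚ 1/ suc n *ℚ 1/ p)
    H-p*suc = begin
      H (p * suc n)
        ≡⟨ cong H (trans (*-suc p n) (+-comm p (p * n))) ⟩
      H (p * n + p)
        ≡⟨ H-+ (p * n) p ⟩
      H (p * n) +ℚ ∑[ i < p ] 1/ suc (p * n + toℕ i)
        ≡⟨ cong (H (p * n) +ℚ_) (∑-last q (λ j → 1/ suc (p * n + j))) ⟩
      H (p * n) +ℚ (B +ℚ 1/ suc (p * n + q))
        ≡⟨ cong (λ t → H (p * n) +ℚ (B +ℚ t)) (trans (cong 1/_ last-term) (1/-* n q)) ⟩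
      H (p * n) +ℚ (B +ℚ 1/ suc n *ℚ 1/ p) ∎
    split : H (p * suc n) - H (suc n) *ℚ 1/ p ≡ (H (p * n) - H n *ℚ 1/ p) +ℚ B
    split = trans (cong (_- H (suc n) *ℚ 1/ p) H-p*suc)
      (solve 5 (λ h b w c hn → (h :+ (b :+ w :* c)) :- (hn :+ w) :* c := (h :- hn :* c) :+ b) refl
        (H (p * n)) B (1/ suc n) (1/ p) (H n))

  divisible-H[pn+k]-H[n]/p-H[k] : ∀ n k → k < p →
                                  Divisible ((H (p * n + k) - H n *ℚ 1/ p) - H k)
  divisible-H[pn+k]-H[n]/p-H[k] n k k<p = subst Divisible (sym split)
    (divisible-+ (divisible-H[pn]-H[n]/p n) (divisible-∑-1/-H (m∣m*n n) k k<p))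
    where
    open +-*-Solver
    S : ℚ
    S = ∑[ i < k ] 1/ suc (p * n + toℕ i)
    split : (H (p * n + k) - H n *ℚ 1/ p) - H k ≡ (H (p * n) - H n *ℚ 1/ p) +ℚ (S - H k)
    split = trans (cong (λ h → (h - H n *ℚ 1/ p) - H k) (H-+ (p * n) k))
      (solve 4 (λ h s c r → (h :+ s :- c) :- r := (h :- c) :+ (s :- r)) refl
        (H (p * n)) S (H n *ℚ 1/ p) (H k))

lemma3p3 : (p n : ℕ) → .{{_ : NonZero p}} → Prime p → 5 ≤ p → 1 ≤ n
    → νₚ≥ p (H n) (+ 1) → νₚ≥ p (H (p * n)) (+ 0)
    → (k : ℕ) → 1 ≤ k → k < p
    → νₚ≥ p ((H (p * n + k) - H n *ℚ ((+ 1) / p)) - H k) (+ 1)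
lemma3p3 (suc q) n p-prime 5≤p _ _ _ k _ k<p =
  pAdic.divisible⇒νₚ≥1 p-prime (OddPrime.divisible-H[pn+k]-H[n]/p-H[k] p-prime p∤2 n k k<p)
  where
  p∤2 : suc q ∤ 2
  p∤2 = >⇒∤ (≤-trans (s≤s (s≤s (s≤s z≤n))) 5≤p)
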